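{- Let $3\leq r<n$ be integers. Then every $n$-vertex $2$-connected $r$-uniform hypergraph $H$ contains a Berge cycle of length at least $\min\{4,n,|E(H)|\}$.
   Context: An $r$-uniform hypergraph is a family of $r$-element subsets (edges) of a finite vertex set. A Berge cycle of length $\ell$ is a list $v_1,e_1,v_2,\ldots,v_\ell,e_\ell,v_1$ of $\ell$ distinct vertices and $\ell$ distinct edges with $\{v_i,v_{i+1}\}\subseteq e_i$ for all $i$ (indices mod $\ell$). The incidence bipartite graph $I_H$ has vertex classes $V(H)$ and $E(H)$, with $x\in V(H)$ adjacent to $y\in E(H)$ iff $x\in y$. $H$ is $2$-connected if $I_H$ is a $2$-connected graph. -}

module Defs where

open import Data.Nat as ℕ using (ℕ; zero; suc; _+_; _≤_; _<_; s≤s)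
open import Data.Nat.Properties using (_<?_)
open import Data.Fin using (Fin; toℕ; fromℕ<)
open import Data.Fin.Subset using (Subset; _∈_; ∣_∣)
open import Data.Sum using (_⊎_; inj₁; inj₂)
open import Data.Product using (Σ; _×_; ∃)
open import Data.Empty using (⊥)
open import Function.Definitions using (Injective)
open import Relation.Binary.PropositionalEquality using (_≡_; _≢_)
open import Relation.Nullary using (yes; no)

record Hypergraph (n r : ℕ) : Set where
  field
    m        : ℕ
    edge     : Fin m → Subset n
    distinct : Injective _≡_ _≡_ edge
    uniform  : ∀ e → ∣ edge e ∣ ≡ r

open Hypergraph public

-- Incidence bipartite graph I_H : nodes are vertices (inj₁) and edges (inj₂).
Node : ∀ {n r} → Hypergraph n r → Set
Node {n} H = Fin n ⊎ Fin (m H)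

Adj : ∀ {n r} (H : Hypergraph n r) → Node H → Node H → Set
Adj H (inj₁ v) (inj₂ e) = v ∈ edge H e
Adj H (inj₂ e) (inj₁ v) = v ∈ edge H e
Adj H (inj₁ _) (inj₁ _) = ⊥
Adj H (inj₂ _) (inj₂ _) = ⊥

data Walk {n r} (H : Hypergraph n r) (ok : Node H → Set) : Node H → Node H → Set where
  here : ∀ {a} → ok a → Walk H ok a a
  step : ∀ {a b c} → ok a → Adj H a b → Walk H ok b c → Walk H ok a c

Connected : ∀ {n r} → Hypergraph n r → Set
Connected H = ∀ a b → Walk H (λ x → Node H) a b

ConnectedWithout : ∀ {n r} (H : Hypergraph n r) → Node H → Set
ConnectedWithout H x = ∀ a b → a ≢ x → b ≢ x → Walk H (λ y → y ≢ x) a b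

-- H is 2-connected iff I_H is a 2-connected graph: more than two nodes,
-- connected, and no cut vertex.
TwoConnected : ∀ {n r} → Hypergraph n r → Set
TwoConnected {n} H = (3 ≤ n + m H) × Connected H × (∀ x → ConnectedWithout H x)

next : ∀ {k} → Fin (suc k) → Fin (suc k)
next {k} i with toℕ i <? k
... | yes p = fromℕ< (s≤s p)
... | no _  = Fin.zero
  where import Data.Fin as Fin

-- A Berge cycle of length ℓ = suc k: distinct vertices v_1..v_ℓ, distinct edges
-- e_1..e_ℓ with {v_i, v_{i+1}} ⊆ e_i (indices mod ℓ).
record BergeCycle {n r} (H : Hypergraph n r) (k : ℕ) : Set where
  field
    vtx      : Fin (suc k) → Fin n
    edg      : Fin (suc k) → Fin (m H)
    vtx-inj  : Injective _≡_ _≡_ vtx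
    edg-inj  : Injective _≡_ _≡_ edg
    incident : ∀ i → (vtx i ∈ edge H (edg i)) × (vtx (next i) ∈ edge H (edg i))

HasBergeCycleOfLengthAtLeast : ∀ {n r} → Hypergraph n r → ℕ → Set
HasBergeCycleOfLengthAtLeast H L = Σ ℕ (λ k → L ≤ suc k × BergeCycle H k)

module Submission where

-- The incidence graph I_H is bipartite and has no cut vertex, and its cycles of length 2ℓ are
-- the Berge cycles of length ℓ. A path between two vertices of an edge e that avoids e closes a
-- first Berge cycle of length at least 2. While a Berge cycle C of length 2 or 3 misses some edge,
-- a walk from that edge reaches C, and every node adjacent to C starts an ear: a path outside C
-- back to C avoiding a prescribed node of C. A long ear gives a longer cycle at once; by parity
-- the only short ears are chords and 2-paths between nodes at distance 2 or 3 on C. Uniformity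
-- r ≥ 3 then yields a vertex off C in a suitable edge, whose own ear either lengthens C or closes
-- a detour replacing one edge of C by a path of two edges.

open import Defs
open import Data.Bool using (Bool; true; false)
open import Data.Empty using (⊥-elim)
open import Data.Fin using (Fin; zero; suc; toℕ; fromℕ; inject₁)
import Data.Fin.Properties as Finₚ
open import Data.Fin.Properties using (toℕ-injective; toℕ-fromℕ; toℕ-fromℕ<; toℕ-inject₁; inject₁ℕ<; any?)
open import Data.Fin.Relation.Unary.Top using (view; ‵fromℕ; ‵inj₁)
open import Data.Fin.Subset as Subset using (Subset; inside; outside; ⁅_⁆; _∪_; _⊆_; _⊂_; ∣_∣)
  renaming (_∈_ to _∈ˢ_; _∉_ to _∉ˢ_)
open import Data.Fin.Subset.Properties
  using (p⊆q⇒∣p∣≤∣q∣; p⊂q⇒∣p∣<∣q∣; ∣⁅x⁆∣≡1; ∣⊥∣≡0; ∣⊤∣≡n; x∈p∪q⁺; x∈p∪q⁻; x∈⁅x⁆; x∈⁅y⁆⇒x≡y; ⊆-antisym; p⊆p∪q; q⊆p∪q; ∉⊥)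
  renaming (_∈?_ to _∈ˢ?_)
open import Data.List using (List; []; _∷_; _++_; [_]; _∷ʳ_; map; length; lookup; drop; reverse)
open import Data.List.Membership.Propositional using (_∈_; _∉_)
open import Data.List.Membership.Propositional.Properties using (∈-lookup)
open import Data.List.Properties using (length-++; ++-assoc; unfold-reverse)
open import Data.List.Relation.Unary.All as All using (All; []; _∷_)
import Data.List.Relation.Unary.All.Properties as All
open import Data.List.Relation.Unary.All.Properties using (map⁻; ¬Any⇒All¬)
open import Data.List.Relation.Unary.AllPairs using ([]; _∷_)
open import Data.List.Relation.Unary.Any using (here; there)
import Data.List.Relation.Unary.Any as Any
import Data.List.Relation.Unary.Any.Properties as Any
open import Data.List.Relation.Unary.Linked as Linked using (Linked; []; [-]; _∷_)
open import Data.List.Relation.Unary.Unique.Propositional using (Unique)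
import Data.List.Relation.Unary.Unique.Propositional.Properties as Unique
open import Data.List.Relation.Unary.Unique.Propositional.Properties using (Unique[x∷xs]⇒x∉xs)
open import Data.Nat using (ℕ; zero; suc; _≤_; _<_; _⊓_; z≤n; s≤s; _+_; _*_)
open import Data.Nat.Properties
  using (≤-refl; ≤-trans; ≤-reflexive; <-≤-trans; <⇒≤; ≤-pred; ≮⇒≥; <-irrefl; n≤1+n; m≤m+n; +-mono-≤; +-monoʳ-≤;
         +-suc; +-comm; *-distribˡ-+; *-cancelˡ-≤; m⊓n≤m; m⊓n≤n; ⊓-monoʳ-≤; _<?_; module ≤-Reasoning)
open import Data.Product using (∃; ∃₂; _×_; _,_; proj₁; proj₂)
open import Data.Sum using (_⊎_; inj₁; inj₂; [_,_]′)
open import Data.Sum.Properties using (≡-dec; inj₁-injective; inj₂-injective)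
open import Data.Vec using ([]; _∷_)
open import Function using (_∘_)
open import Relation.Binary.Definitions using (DecidableEquality)
open import Relation.Binary.PropositionalEquality using (_≡_; _≢_; refl; sym; trans; cong; subst; ≢-sym)
open import Relation.Nullary using (¬_; yes; no; ¬?)
open import Relation.Nullary.Decidable using (_×-dec_; decidable-stable)
open import Relation.Unary using (Decidable)

private
  variable
    A B : Set

module _ {R : A → A → Set} where

  linked-∷ʳ : ∀ {a b} (xs : List A) → Linked R (xs ∷ʳ a) → R a b → Linked R (xs ∷ʳ a ∷ʳ b)
  linked-∷ʳ []           _         Rab = Rab ∷ [-]
  linked-∷ʳ (x ∷ [])     (Rxa ∷ _) Rab = Rxa ∷ Rab ∷ [-]
  linked-∷ʳ (x ∷ y ∷ xs) (Rxy ∷ l) Rab = Rxy ∷ linked-∷ʳ (y ∷ xs) l Rab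

  linked-glue : ∀ {c} (xs ys : List A) → Linked R (xs ∷ʳ c) → Linked R (c ∷ ys) → Linked R (xs ++ c ∷ ys)
  linked-glue []           ys _         l = l
  linked-glue (x ∷ [])     ys (Rxc ∷ _) l = Rxc ∷ l
  linked-glue (x ∷ y ∷ xs) ys (Rxy ∷ l) l′ = Rxy ∷ linked-glue (y ∷ xs) ys l l′

unique-reverse : ∀ {xs : List A} → Unique xs → Unique (reverse xs)
unique-reverse {xs = []}     []         = []
unique-reverse {xs = x ∷ xs} (x∉xs ∷ u) = subst Unique (sym (unfold-reverse x xs))
  (Unique.++⁺ (unique-reverse u) ([] ∷ []) λ { (x∈ , here refl) → All.lookup x∉xs (Any.reverse⁻ x∈) refl })

linked-drop : ∀ {R : A → A → Set} k {xs} → Linked R xs → Linked R (drop k xs)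
linked-drop zero                 l  = l
linked-drop (suc k) {xs = []}    [] = []
linked-drop (suc k) {xs = _ ∷ _} l  = linked-drop k (Linked.tail l)

module _ {x : A} where

  drop-through : {xs : List A} → x ∈ xs → List A
  drop-through {_ ∷ xs} (here _)  = xs
  drop-through {_ ∷ _}  (there p) = drop-through p

  all-drop-through : ∀ {P : A → Set} {xs} (p : x ∈ xs) → All P xs → All P (x ∷ drop-through p)
  all-drop-through (here refl) ps       = ps
  all-drop-through (there p)   (_ ∷ ps) = all-drop-through p ps

  unique-drop-through : ∀ {xs} (p : x ∈ xs) → Unique xs → Unique (x ∷ drop-through p)
  unique-drop-through (here refl) u       = u
  unique-drop-through (there p)   (_ ∷ u) = unique-drop-through p u

  linked-drop-through : ∀ {R : A → A → Set} {xs c} (p : x ∈ xs) → Linked R (xs ∷ʳ c) → Linked R (x ∷ drop-through p ∷ʳ c)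
  linked-drop-through                  (here refl)         l       = l
  linked-drop-through {xs = _ ∷ []}    (there ())          _
  linked-drop-through {xs = _ ∷ _ ∷ _} (there p)           (_ ∷ l) = linked-drop-through p l

  ∈-rotate : ∀ {y} xs → y ∈ xs ∷ʳ x → y ∈ x ∷ xs
  ∈-rotate []       (here y≡x) = here y≡x
  ∈-rotate (_ ∷ _)  (here y≡z) = there (here y≡z)
  ∈-rotate (_ ∷ xs) (there y∈) with ∈-rotate xs y∈
  ... | here y≡x   = here y≡x
  ... | there y∈xs = there (there y∈xs)

  all-rotate : ∀ {P : A → Set} {xs} → All P (x ∷ xs) → All P (xs ∷ʳ x)
  all-rotate (px ∷ pxs) = All.∷ʳ⁺ pxs px

  unique-rotate : ∀ {xs} → Unique (x ∷ xs) → Unique (xs ∷ʳ x)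
  unique-rotate (x∉ ∷ u) = Unique.++⁺ u ([] ∷ []) λ { (y∈xs , here refl) → All.lookup x∉ y∈xs refl }

next-fromℕ : ∀ k → next (fromℕ k) ≡ zero
next-fromℕ k with toℕ (fromℕ k) <? k
... | yes lt = ⊥-elim (<-irrefl (toℕ-fromℕ k) lt)
... | no _  = refl

next-inject₁ : ∀ {k} (j : Fin k) → next (inject₁ j) ≡ suc j
next-inject₁ {k} j with toℕ (inject₁ j) <? k
... | yes lt = toℕ-injective (trans (toℕ-fromℕ< (s≤s lt)) (cong suc (toℕ-inject₁ j)))
... | no ≮  = ⊥-elim (≮ (inject₁ℕ< j))

module _ {R : A → A → Set} where

  linked-lookup-inject₁ : ∀ {x y} (xs : List A) → Linked R (x ∷ xs ∷ʳ y) →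
                          (j : Fin (length xs)) → R (lookup (x ∷ xs) (inject₁ j)) (lookup (x ∷ xs) (suc j))
  linked-lookup-inject₁ (_ ∷ xs) (Rxz ∷ _) zero    = Rxz
  linked-lookup-inject₁ (_ ∷ xs) (_ ∷ l)   (suc j) = linked-lookup-inject₁ xs l j

  linked-lookup-last : ∀ {x y} (xs : List A) → Linked R (x ∷ xs ∷ʳ y) → R (lookup (x ∷ xs) (fromℕ (length xs))) y
  linked-lookup-last []       (Rxy ∷ _) = Rxy
  linked-lookup-last (_ ∷ xs) (_ ∷ l)   = linked-lookup-last xs l

  linked-cyclic : ∀ {x} (xs : List A) → Linked R (x ∷ xs ∷ʳ x) →
                  ∀ i → R (lookup (x ∷ xs) i) (lookup (x ∷ xs) (next i))
  linked-cyclic xs l i with view i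
  ... | ‵fromℕ rewrite next-fromℕ (length xs) = linked-lookup-last xs l
  ... | ‵inj₁ {i = j} _ rewrite next-inject₁ j = linked-lookup-inject₁ xs l j

unique-map-lookup-injective : (f : A → B) (xs : List A) → Unique (map f xs) →
                              ∀ {i j} → f (lookup xs i) ≡ f (lookup xs j) → i ≡ j
unique-map-lookup-injective f (x ∷ xs) (fx∉ ∷ u) {zero}  {zero}  _  = refl
unique-map-lookup-injective f (x ∷ xs) (fx∉ ∷ u) {zero}  {suc j} eq = ⊥-elim (All.lookup (map⁻ fx∉) (∈-lookup j) eq)
unique-map-lookup-injective f (x ∷ xs) (fx∉ ∷ u) {suc i} {zero}  eq = ⊥-elim (All.lookup (map⁻ fx∉) (∈-lookup i) (sym eq))
unique-map-lookup-injective f (x ∷ xs) (fx∉ ∷ u) {suc i} {suc j} eq = cong suc (unique-map-lookup-injective f xs u eq)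

-- Counting in finite subsets

∣p∪q∣≤∣p∣+∣q∣ : ∀ {n} (p q : Subset n) → ∣ p ∪ q ∣ ≤ ∣ p ∣ + ∣ q ∣
∣p∪q∣≤∣p∣+∣q∣ []            []            = z≤n
∣p∪q∣≤∣p∣+∣q∣ (inside ∷ p)  (inside ∷ q)  = s≤s (≤-trans (∣p∪q∣≤∣p∣+∣q∣ p q) (+-monoʳ-≤ ∣ p ∣ (n≤1+n ∣ q ∣)))
∣p∪q∣≤∣p∣+∣q∣ (inside ∷ p)  (outside ∷ q) = s≤s (∣p∪q∣≤∣p∣+∣q∣ p q)
∣p∪q∣≤∣p∣+∣q∣ (outside ∷ p) (inside ∷ q)  = ≤-trans (s≤s (∣p∪q∣≤∣p∣+∣q∣ p q)) (≤-reflexive (sym (+-suc ∣ p ∣ ∣ q ∣)))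
∣p∪q∣≤∣p∣+∣q∣ (outside ∷ p) (outside ∷ q) = ∣p∪q∣≤∣p∣+∣q∣ p q

module _ {n : ℕ} where

  ⋃⁅_⁆ : List (Fin n) → Subset n
  ⋃⁅ xs ⁆ = Subset.⋃ (map ⁅_⁆ xs)

  ∣⋃⁅xs⁆∣≤length : ∀ xs → ∣ ⋃⁅ xs ⁆ ∣ ≤ length xs
  ∣⋃⁅xs⁆∣≤length []       = ≤-reflexive (∣⊥∣≡0 n)
  ∣⋃⁅xs⁆∣≤length (x ∷ xs) = ≤-trans (∣p∪q∣≤∣p∣+∣q∣ ⁅ x ⁆ ⋃⁅ xs ⁆) (+-mono-≤ (≤-reflexive (∣⁅x⁆∣≡1 x)) (∣⋃⁅xs⁆∣≤length xs))

  ∈⇒∈⋃⁅xs⁆ : ∀ {z xs} → z ∈ xs → z ∈ˢ ⋃⁅ xs ⁆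
  ∈⇒∈⋃⁅xs⁆ (here refl) = x∈p∪q⁺ (inj₁ (x∈⁅x⁆ _))
  ∈⇒∈⋃⁅xs⁆ (there z∈xs) = x∈p∪q⁺ (inj₂ (∈⇒∈⋃⁅xs⁆ z∈xs))

  ∈⋃⁅xs⁆⇒∈ : ∀ {z} xs → z ∈ˢ ⋃⁅ xs ⁆ → z ∈ xs
  ∈⋃⁅xs⁆⇒∈ []       z∈∅ = ⊥-elim (∉⊥ z∈∅)
  ∈⋃⁅xs⁆⇒∈ (x ∷ xs) z∈  with x∈p∪q⁻ ⁅ x ⁆ ⋃⁅ xs ⁆ z∈
  ... | inj₁ z∈⁅x⁆ = here (x∈⁅y⁆⇒x≡y x z∈⁅x⁆)
  ... | inj₂ z∈xs  = there (∈⋃⁅xs⁆⇒∈ xs z∈xs)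

  fresh-or-⊆ : ∀ xs p → (∃ λ z → z ∈ˢ p × All (z ≢_) xs) ⊎ p ⊆ ⋃⁅ xs ⁆
  fresh-or-⊆ xs p with any? (λ z → z ∈ˢ? p ×-dec ¬? (Any.any? (z Finₚ.≟_) xs))
  ... | yes (z , z∈p , z∉xs) = inj₁ (z , z∈p , ¬Any⇒All¬ xs z∉xs)
  ... | no none              =
    inj₂ λ {z} z∈p → ∈⇒∈⋃⁅xs⁆ (decidable-stable (Any.any? (z Finₚ.≟_) xs) λ z∉xs → none (z , z∈p , z∉xs))

  ∃-fresh : ∀ xs p → length xs < ∣ p ∣ → ∃ λ z → z ∈ˢ p × All (z ≢_) xs
  ∃-fresh xs p xs<p with fresh-or-⊆ xs p
  ... | inj₁ found = found
  ... | inj₂ p⊆xs  = ⊥-elim (<-irrefl refl (<-≤-trans xs<p (≤-trans (p⊆q⇒∣p∣≤∣q∣ p⊆xs) (∣⋃⁅xs⁆∣≤length xs))))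

  p⊆q∧∣q∣≤∣p∣⇒p≡q : ∀ {p q : Subset n} → p ⊆ q → ∣ q ∣ ≤ ∣ p ∣ → p ≡ q
  p⊆q∧∣q∣≤∣p∣⇒p≡q {p} {q} p⊆q q≤p = ⊆-antisym p⊆q q⊆p
    where
    q⊆p : q ⊆ p
    q⊆p {x} x∈q with x ∈ˢ? p
    ... | yes x∈p = x∈p
    ... | no  x∉p = ⊥-elim (<-irrefl refl (<-≤-trans (p⊂q⇒∣p∣<∣q∣ (p⊆q , x , x∈q , x∉p)) q≤p))

  p⊆q∪⁅a⁆⇒∣p∣<∣q∣ : ∀ {p q : Subset n} {a b c} → p ⊆ q ∪ ⁅ a ⁆ → b ∈ˢ q → c ∈ˢ q → b ∉ˢ p → c ∉ˢ p → b ≢ c → ∣ p ∣ < ∣ q ∣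
  p⊆q∪⁅a⁆⇒∣p∣<∣q∣ {p} {q} {a} {b} {c} p⊆q∪a b∈q c∈q b∉p c∉p b≢c = ≤-pred (begin
    suc (suc ∣ p ∣)    ≤⟨ s≤s (p⊂q⇒∣p∣<∣q∣ p⊂p∪b) ⟩
    suc ∣ p ∪ ⁅ b ⁆ ∣  ≤⟨ p⊂q⇒∣p∣<∣q∣ p∪b⊂q∪a ⟩
    ∣ q ∪ ⁅ a ⁆ ∣      ≤⟨ ∣p∪q∣≤∣p∣+∣q∣ q ⁅ a ⁆ ⟩
    ∣ q ∣ + ∣ ⁅ a ⁆ ∣  ≡⟨ cong (∣ q ∣ +_) (∣⁅x⁆∣≡1 a) ⟩
    ∣ q ∣ + 1          ≡⟨ +-comm ∣ q ∣ 1 ⟩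
    suc ∣ q ∣          ∎)
    where
    open ≤-Reasoning
    p⊂p∪b : p ⊂ p ∪ ⁅ b ⁆
    p⊂p∪b = p⊆p∪q ⁅ b ⁆ , b , q⊆p∪q p ⁅ b ⁆ (x∈⁅x⁆ b) , b∉p
    p∪b⊆q∪a : p ∪ ⁅ b ⁆ ⊆ q ∪ ⁅ a ⁆
    p∪b⊆q∪a x∈ with x∈p∪q⁻ p ⁅ b ⁆ x∈
    ... | inj₁ x∈p = p⊆q∪a x∈p
    ... | inj₂ x∈b rewrite x∈⁅y⁆⇒x≡y b x∈b = p⊆p∪q ⁅ a ⁆ b∈q
    c∉p∪b : c ∉ˢ p ∪ ⁅ b ⁆
    c∉p∪b c∈ with x∈p∪q⁻ p ⁅ b ⁆ c∈
    ... | inj₁ c∈p = c∉p c∈p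
    ... | inj₂ c∈b = b≢c (sym (x∈⁅y⁆⇒x≡y b c∈b))
    p∪b⊂q∪a : p ∪ ⁅ b ⁆ ⊂ q ∪ ⁅ a ⁆
    p∪b⊂q∪a = p∪b⊆q∪a , c , p⊆p∪q ⁅ a ⁆ c∈q , c∉p∪b

  ∃-fresh-in-other : ∀ xs {p q : Subset n} → p ⊆ ⋃⁅ xs ⁆ → length xs ≤ ∣ p ∣ → ∣ p ∣ ≡ ∣ q ∣ → p ≢ q →
                     ∃ λ z → z ∈ˢ q × All (z ≢_) xs
  ∃-fresh-in-other xs {p} {q} p⊆xs xs≤p p≡q p≢q with fresh-or-⊆ xs q
  ... | inj₁ found = found
  ... | inj₂ q⊆xs  = ⊥-elim (p≢q (trans (p⊆q∧∣q∣≤∣p∣⇒p≡q p⊆xs xs≥p) (sym (p⊆q∧∣q∣≤∣p∣⇒p≡q q⊆xs xs≥q))))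
    where
    xs≥p : ∣ ⋃⁅ xs ⁆ ∣ ≤ ∣ p ∣
    xs≥p = ≤-trans (∣⋃⁅xs⁆∣≤length xs) xs≤p
    xs≥q : ∣ ⋃⁅ xs ⁆ ∣ ≤ ∣ q ∣
    xs≥q = ≤-trans xs≥p (≤-reflexive p≡q)

-- Berge cycles and the incidence graph

module _ {n r : ℕ} (H : Hypergraph n r) where

  _∈ₑ_ : Fin n → Fin (m H) → Set
  v ∈ₑ e = v ∈ˢ edge H e

  Flag : Set
  Flag = Fin n × Fin (m H)

  _↝_ : Flag → Flag → Set
  (_ , e) ↝ (w , _) = w ∈ₑ e

  record BergeList (p : Flag) (ps : List Flag) : Set where
    field
      vertices-unique : Unique (map proj₁ (p ∷ ps))
      edges-unique    : Unique (map proj₂ (p ∷ ps))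
      incident        : All (λ (v , e) → v ∈ₑ e) (p ∷ ps)
      linked          : Linked _↝_ (p ∷ ps ∷ʳ p)

  bergeCycle : ∀ {p ps} → BergeList p ps → BergeCycle H (length ps)
  bergeCycle {p} {ps} B = record
    { vtx      = proj₁ ∘ lookup (p ∷ ps)
    ; edg      = proj₂ ∘ lookup (p ∷ ps)
    ; vtx-inj  = unique-map-lookup-injective proj₁ (p ∷ ps) vertices-unique
    ; edg-inj  = unique-map-lookup-injective proj₂ (p ∷ ps) edges-unique
    ; incident = λ i → All.lookup incident (∈-lookup i) , linked-cyclic ps linked i
    }
    where open BergeList B

  HasBergeCycle≥ : ℕ → Set
  HasBergeCycle≥ = HasBergeCycleOfLengthAtLeast H

  bergeList⇒HasBergeCycle≥ : ∀ {L p ps} → BergeList p ps → L ≤ length (p ∷ ps) → HasBergeCycle≥ L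
  bergeList⇒HasBergeCycle≥ {ps = ps} B L≤ = length ps , L≤ , bergeCycle B

  HasBergeCycle≥-mono : ∀ {L L′} → L′ ≤ L → HasBergeCycle≥ L → HasBergeCycle≥ L′
  HasBergeCycle≥-mono L′≤L (k , L≤ , C) = k , ≤-trans L′≤L L≤ , C

  adj-sym : ∀ {a b} → Adj H a b → Adj H b a
  adj-sym {inj₁ _} {inj₂ _} a∼b = a∼b
  adj-sym {inj₂ _} {inj₁ _} a∼b = a∼b

  IsCycle : Node H → List (Node H) → Set
  IsCycle x xs = Unique (x ∷ xs) × Linked (Adj H) (x ∷ xs ∷ʳ x)

  CycleThrough≥ : ℕ → Node H → Set
  CycleThrough≥ k x = ∃ λ xs → IsCycle x xs × k ≤ length (x ∷ xs)

  data Alternating : List (Node H) → List Flag → Set where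
    []  : Alternating [] []
    step : ∀ {v e zs ps} → Alternating zs ps → Alternating (inj₁ v ∷ inj₂ e ∷ zs) ((v , e) ∷ ps)

  alternate : ∀ {v w} zs → Linked (Adj H) (inj₁ v ∷ zs ∷ʳ inj₁ w) → ∃ (Alternating (inj₁ v ∷ zs))
  alternate []                     (() ∷ _)
  alternate (inj₁ _ ∷ _)           (() ∷ _)
  alternate (inj₂ _ ∷ [])          _           = _ , step []
  alternate (inj₂ _ ∷ inj₂ _ ∷ _)  (_ ∷ () ∷ _)
  alternate (inj₂ _ ∷ inj₁ _ ∷ zs) (_ ∷ _ ∷ l) = _ , step (proj₂ (alternate zs l))

  alternating-length : ∀ {zs ps} → Alternating zs ps → length zs ≡ 2 * length ps
  alternating-length []              = refl
  alternating-length (step {ps = ps} a) = trans (cong (2 +_) (alternating-length a)) (sym (*-distribˡ-+ 2 1 (length ps)))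

  alternating-fresh-vertex : ∀ {v zs ps} → Alternating zs ps → All (inj₁ v ≢_) zs → All (v ≢_) (map proj₁ ps)
  alternating-fresh-vertex []       _               = []
  alternating-fresh-vertex (step a) (v≢ ∷ _ ∷ v∉) = (v≢ ∘ cong inj₁) ∷ alternating-fresh-vertex a v∉

  alternating-fresh-edge : ∀ {e zs ps} → Alternating zs ps → All (inj₂ e ≢_) zs → All (e ≢_) (map proj₂ ps)
  alternating-fresh-edge []       _               = []
  alternating-fresh-edge (step a) (_ ∷ e≢ ∷ e∉) = (e≢ ∘ cong inj₂) ∷ alternating-fresh-edge a e∉

  alternating-vertices-unique : ∀ {zs ps} → Alternating zs ps → Unique zs → Unique (map proj₁ ps)
  alternating-vertices-unique []       _                 = []
  alternating-vertices-unique (step a) ((_ ∷ v∉) ∷ _ ∷ u) = alternating-fresh-vertex a v∉ ∷ alternating-vertices-unique a u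

  alternating-edges-unique : ∀ {zs ps} → Alternating zs ps → Unique zs → Unique (map proj₂ ps)
  alternating-edges-unique []       _            = []
  alternating-edges-unique (step a) (_ ∷ e∉ ∷ u) = alternating-fresh-edge a e∉ ∷ alternating-edges-unique a u

  alternating-incident : ∀ {zs ps w} → Alternating zs ps → Linked (Adj H) (zs ∷ʳ w) → All (λ (v , e) → v ∈ₑ e) ps
  alternating-incident []       _         = []
  alternating-incident (step a) (v∈e ∷ l) = v∈e ∷ alternating-incident a (Linked.tail l)

  alternating-linked : ∀ {zs ps w} → Alternating zs ps → Linked (Adj H) (zs ∷ʳ inj₁ w) → ∀ f → Linked _↝_ (ps ∷ʳ (w , f))
  alternating-linked []              _             _ = [-]
  alternating-linked (step [])       (_ ∷ w∈e ∷ _) _ = w∈e ∷ [-]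
  alternating-linked (step (step a)) (_ ∷ u∈e ∷ l) f = u∈e ∷ alternating-linked (step a) l f

  rotate-cycle : ∀ {x y} xs → IsCycle x (y ∷ xs) → IsCycle y (xs ∷ʳ x)
  rotate-cycle {y = y} xs (u , x∼y ∷ l) = unique-rotate u , linked-∷ʳ (y ∷ xs) l x∼y

  BergeListOfHalfLength : Node H → List (Node H) → Set
  BergeListOfHalfLength x xs = ∃₂ λ p ps → BergeList p ps × length (x ∷ xs) ≡ 2 * length (p ∷ ps)

  vertex-cycle⇒bergeList : ∀ {v} xs → IsCycle (inj₁ v) xs → BergeListOfHalfLength (inj₁ v) xs
  vertex-cycle⇒bergeList {v} xs (u , l) with alternate xs l
  ... | _ , a@(step {e = e} _) = _ , _ , flags , alternating-length a
    where
    flags : BergeList (v , e) _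
    flags = record
      { vertices-unique = alternating-vertices-unique a u
      ; edges-unique    = alternating-edges-unique a u
      ; incident        = alternating-incident a l
      ; linked          = alternating-linked a l e
      }

  cycle⇒bergeList : ∀ {x} xs → IsCycle x xs → BergeListOfHalfLength x xs
  cycle⇒bergeList {inj₁ v} xs                c            = vertex-cycle⇒bergeList xs c
  cycle⇒bergeList {inj₂ e} []                (_ , () ∷ _)
  cycle⇒bergeList {inj₂ e} (inj₂ _ ∷ xs)     (_ , () ∷ _)
  cycle⇒bergeList {inj₂ e} (inj₁ v ∷ xs)     c            with vertex-cycle⇒bergeList (xs ∷ʳ inj₂ e) (rotate-cycle xs c)
  ... | p , ps , flags , len≡ = p , ps , flags , trans (cong suc (sym len-rotated)) len≡
    where
    len-rotated : length (xs ∷ʳ inj₂ e) ≡ suc (length xs)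
    len-rotated = trans (length-++ xs) (+-comm (length xs) 1)

  cycle⇒bergeList≥ : ∀ {L x} → CycleThrough≥ (2 * L) x → ∃₂ λ p ps → BergeList p ps × L ≤ length (p ∷ ps)
  cycle⇒bergeList≥ (xs , c , 2L≤) with cycle⇒bergeList xs c
  ... | p , ps , flags , len≡ = p , ps , flags , *-cancelˡ-≤ 2 (≤-trans 2L≤ (≤-reflexive len≡))

  cycle⇒HasBergeCycle≥ : ∀ {L x} → CycleThrough≥ (2 * L) x → HasBergeCycle≥ L
  cycle⇒HasBergeCycle≥ c with cycle⇒bergeList≥ c
  ... | _ , _ , flags , L≤ = bergeList⇒HasBergeCycle≥ flags L≤

  _≟ₙ_ : DecidableEquality (Node H)
  _≟ₙ_ = ≡-dec Finₚ._≟_ Finₚ._≟_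

  open import Data.List.Membership.DecPropositional _≟ₙ_ using (_∈?_)

  walk-start : ∀ {ok a b} → Walk H ok a b → ok a
  walk-start (here ok)     = ok
  walk-start (step ok _ _) = ok

  record Ear (T ok : Node H → Set) (a : Node H) : Set where
    constructor mkEar
    field
      inner   : List (Node H)
      end     : Node H
      path    : Linked (Adj H) (a ∷ inner ∷ʳ end)
      simple  : Unique (a ∷ inner)
      avoids  : All (¬_ ∘ T) (a ∷ inner)
      lands   : T end
      end-ok  : ok end

  find-ear : ∀ {T ok a b} → Decidable T → Walk H ok a b → T b → T a ⊎ Ear T ok a
  find-ear {a = a} T? w Tb with T? a
  ... | yes Ta = inj₁ Ta
  find-ear T? (here _) Tb | no ¬Ta = ⊥-elim (¬Ta Tb)
  find-ear {a = a} T? (step _ a∼b w) Tb | no ¬Ta with find-ear T? w Tb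
  ... | inj₁ Tb′ = inj₂ (mkEar [] _ (a∼b ∷ [-]) ([] ∷ []) (¬Ta ∷ []) Tb′ (walk-start w))
  ... | inj₂ (mkEar I c path simple avoids lands end-ok) with a ∈? (_ ∷ I)
  ...   | yes a∈ = inj₂ (mkEar (drop-through a∈) c (linked-drop-through a∈ path) (unique-drop-through a∈ simple)
                                (all-drop-through a∈ avoids) lands end-ok)
  ...   | no  a∉ = inj₂ (mkEar (_ ∷ I) c (a∼b ∷ path) (¬Any⇒All¬ _ a∉ ∷ simple) (¬Ta ∷ avoids) lands end-ok)

  close-ear : ∀ {T ok x k} (E : Ear T ok x) → let open Ear E in
              ∀ arc → Unique (end ∷ arc) → All T (end ∷ arc) → Linked (Adj H) (end ∷ arc ∷ʳ x) →
              k ≤ 2 + length arc + length inner → CycleThrough≥ k x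
  close-ear {x = x} {k} (mkEar inner end path simple avoids _ _) arc simple-arc on-T closed-arc k≤ =
    inner ++ end ∷ arc , (cycle-simple , cycle-closed) , ≤-trans k≤ (≤-reflexive len≡)
    where
    cycle-simple : Unique (x ∷ inner ++ end ∷ arc)
    cycle-simple = Unique.++⁺ simple simple-arc λ (y∈path , y∈arc) → All.lookup avoids y∈path (All.lookup on-T y∈arc)
    cycle-closed : Linked (Adj H) (x ∷ (inner ++ end ∷ arc) ∷ʳ x)
    cycle-closed = subst (λ ys → Linked (Adj H) (x ∷ ys)) (sym (++-assoc inner (end ∷ arc) [ x ]))
                         (linked-glue (x ∷ inner) (arc ∷ʳ x) path closed-arc)
    len≡ : 2 + length arc + length inner ≡ length (x ∷ inner ++ end ∷ arc)
    len≡ = cong suc (trans (cong suc (+-comm (length arc) (length inner)))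
                           (sym (trans (length-++ inner) (+-suc (length inner) (length arc)))))

  side : Node H → Bool
  side (inj₁ _) = true
  side (inj₂ _) = false

  same-side : ∀ {a b c} → Adj H a b → Adj H b c → side a ≡ side c
  same-side {inj₁ _} {inj₂ _} {inj₁ _} _ _ = refl
  same-side {inj₂ _} {inj₁ _} {inj₂ _} _ _ = refl
  same-side {inj₁ _} {inj₁ _}          () _
  same-side {inj₂ _} {inj₂ _}          () _
  same-side {b = inj₁ _} {inj₁ _}      _  ()
  same-side {b = inj₂ _} {inj₂ _}      _  ()

  same-side⇒¬adj : ∀ {a b} → side a ≡ side b → ¬ Adj H a b
  same-side⇒¬adj {inj₁ _} {inj₂ _} () _
  same-side⇒¬adj {inj₂ _} {inj₁ _} () _

  record Cycle₆ : Set where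
    field
      c₀ c₁ c₂ c₃ c₄ c₅ : Node H
      simple : Unique (c₀ ∷ c₁ ∷ c₂ ∷ c₃ ∷ c₄ ∷ c₅ ∷ [])
      c₀∼c₁ : Adj H c₀ c₁
      c₁∼c₂ : Adj H c₁ c₂
      c₂∼c₃ : Adj H c₂ c₃
      c₃∼c₄ : Adj H c₃ c₄
      c₄∼c₅ : Adj H c₄ c₅
      c₅∼c₀ : Adj H c₅ c₀

    nodes forward backward : List (Node H)
    nodes    = c₀ ∷ c₁ ∷ c₂ ∷ c₃ ∷ c₄ ∷ c₅ ∷ []
    forward  = c₁ ∷ c₂ ∷ c₃ ∷ c₄ ∷ c₅ ∷ c₀ ∷ []
    backward = c₅ ∷ c₄ ∷ c₃ ∷ c₂ ∷ c₁ ∷ c₀ ∷ []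

    forward-simple : Unique forward
    forward-simple = unique-rotate simple

    backward-simple : Unique backward
    backward-simple = unique-reverse simple

    forward-on : All (_∈ nodes) forward
    forward-on = All.tabulate (∈-rotate (c₁ ∷ c₂ ∷ c₃ ∷ c₄ ∷ c₅ ∷ []))

    backward-on : All (_∈ nodes) backward
    backward-on = All.tabulate (Any.reverse⁻ {xs = nodes})

    forward-closed : ∀ {x} → Adj H c₀ x → Linked (Adj H) (forward ∷ʳ x)
    forward-closed c₀∼x = c₁∼c₂ ∷ c₂∼c₃ ∷ c₃∼c₄ ∷ c₄∼c₅ ∷ c₅∼c₀ ∷ c₀∼x ∷ [-]

    backward-closed : ∀ {x} → Adj H c₀ x → Linked (Adj H) (backward ∷ʳ x)
    backward-closed c₀∼x = adj-sym c₄∼c₅ ∷ adj-sym c₃∼c₄ ∷ adj-sym c₂∼c₃ ∷ adj-sym c₁∼c₂ ∷ adj-sym c₀∼c₁ ∷ c₀∼x ∷ [-]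

  data Ear₆ (C : Cycle₆) (x : Node H) : Set where
    longer  : CycleThrough≥ 8 x → Ear₆ C x
    chord₂  : Adj H x (Cycle₆.c₂ C) → Ear₆ C x
    chord₄  : Adj H x (Cycle₆.c₄ C) → Ear₆ C x
    bridge₃ : ∀ y → y ∉ Cycle₆.nodes C → Adj H x y → Adj H y (Cycle₆.c₃ C) → Ear₆ C x

  -- An ear from c₀ through q nodes off C to cⱼ closes a cycle of length q + 1 + max j (6 ∸ j), and
  -- bipartiteness forces q + 1 ≡ j (mod 2): only the ears of chord₂, chord₄ and bridge₃ stay below 8.
  close-ear₆ : (C : Cycle₆) {x : Node H} → Adj H (Cycle₆.c₀ C) x →
               Ear (_∈ Cycle₆.nodes C) (_≢ Cycle₆.c₀ C) x → Ear₆ C x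
  close-ear₆ C {x} c₀∼x = λ where
      (mkEar _ _ _ _ _ (here refl) end≢c₀) → ⊥-elim (end≢c₀ refl)
      (mkEar [] _ (x∼c₁ ∷ _) _ _ (there (here refl)) _) → ⊥-elim (same-side⇒¬adj x≈c₁ x∼c₁)
      E@(mkEar (_ ∷ I) _ _ _ _ (there (here refl)) _) →
        longer (close-ear E _ forward-simple forward-on (forward-closed c₀∼x) (m≤m+n 8 (length I)))
      (mkEar [] _ (x∼c₂ ∷ _) _ _ (there (there (here refl))) _) → chord₂ x∼c₂
      (mkEar (_ ∷ []) _ (x∼y ∷ y∼c₂ ∷ _) _ _ (there (there (here refl))) _) →
        ⊥-elim (same-side⇒¬adj (trans (neighbour≈c₀ x∼y) c₀≈c₂) y∼c₂)
      E@(mkEar (_ ∷ _ ∷ I) _ _ _ _ (there (there (here refl))) _) →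
        longer (close-ear E _ (Unique.drop⁺ 1 forward-simple) (All.drop⁺ 1 forward-on)
                              (linked-drop 1 (forward-closed c₀∼x)) (m≤m+n 8 (length I)))
      (mkEar [] _ (x∼c₃ ∷ _) _ _ (there (there (there (here refl)))) _) → ⊥-elim (same-side⇒¬adj x≈c₃ x∼c₃)
      (mkEar (y ∷ []) _ (x∼y ∷ y∼c₃ ∷ _) _ (_ ∷ y∉C ∷ []) (there (there (there (here refl)))) _) → bridge₃ y y∉C x∼y y∼c₃
      (mkEar (_ ∷ _ ∷ []) _ (x∼y ∷ y∼z ∷ z∼c₃ ∷ _) _ _ (there (there (there (here refl)))) _) →
        ⊥-elim (same-side⇒¬adj (trans (sym (same-side x∼y y∼z)) x≈c₃) z∼c₃)
      E@(mkEar (_ ∷ _ ∷ _ ∷ I) _ _ _ _ (there (there (there (here refl)))) _) →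
        longer (close-ear E _ (Unique.drop⁺ 2 forward-simple) (All.drop⁺ 2 forward-on)
                              (linked-drop 2 (forward-closed c₀∼x)) (m≤m+n 8 (length I)))
      (mkEar [] _ (x∼c₄ ∷ _) _ _ (there (there (there (there (here refl))))) _) → chord₄ x∼c₄
      (mkEar (_ ∷ []) _ (x∼y ∷ y∼c₄ ∷ _) _ _ (there (there (there (there (here refl))))) _) →
        ⊥-elim (same-side⇒¬adj (trans (neighbour≈c₀ x∼y) c₀≈c₄) y∼c₄)
      E@(mkEar (_ ∷ _ ∷ I) _ _ _ _ (there (there (there (there (here refl))))) _) →
        longer (close-ear E _ (Unique.drop⁺ 1 backward-simple) (All.drop⁺ 1 backward-on)
                              (linked-drop 1 (backward-closed c₀∼x)) (m≤m+n 8 (length I)))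
      (mkEar [] _ (x∼c₅ ∷ _) _ _ (there (there (there (there (there (here refl)))))) _) → ⊥-elim (same-side⇒¬adj x≈c₅ x∼c₅)
      E@(mkEar (_ ∷ I) _ _ _ _ (there (there (there (there (there (here refl)))))) _) →
        longer (close-ear E _ backward-simple backward-on (backward-closed c₀∼x) (m≤m+n 8 (length I)))
    where
    open Cycle₆ C
    x∼c₀ : Adj H x c₀
    x∼c₀ = adj-sym c₀∼x
    neighbour≈c₀ : ∀ {y} → Adj H x y → side y ≡ side c₀
    neighbour≈c₀ x∼y = same-side (adj-sym x∼y) x∼c₀
    x≈c₁ : side x ≡ side c₁
    x≈c₁ = same-side x∼c₀ c₀∼c₁
    x≈c₃ : side x ≡ side c₃
    x≈c₃ = trans x≈c₁ (same-side c₁∼c₂ c₂∼c₃)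
    x≈c₅ : side x ≡ side c₅
    x≈c₅ = same-side x∼c₀ (adj-sym c₅∼c₀)
    c₀≈c₂ : side c₀ ≡ side c₂
    c₀≈c₂ = same-side c₀∼c₁ c₁∼c₂
    c₀≈c₄ : side c₀ ≡ side c₄
    c₀≈c₄ = same-side (adj-sym c₅∼c₀) (adj-sym c₄∼c₅)

  record Cycle₄ : Set where
    field
      c₀ c₁ c₂ c₃ : Node H
      simple : Unique (c₀ ∷ c₁ ∷ c₂ ∷ c₃ ∷ [])
      c₀∼c₁ : Adj H c₀ c₁
      c₁∼c₂ : Adj H c₁ c₂
      c₂∼c₃ : Adj H c₂ c₃
      c₃∼c₀ : Adj H c₃ c₀

    nodes forward backward : List (Node H)
    nodes    = c₀ ∷ c₁ ∷ c₂ ∷ c₃ ∷ []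
    forward  = c₁ ∷ c₂ ∷ c₃ ∷ c₀ ∷ []
    backward = c₃ ∷ c₂ ∷ c₁ ∷ c₀ ∷ []

    forward-simple : Unique forward
    forward-simple = unique-rotate simple

    backward-simple : Unique backward
    backward-simple = unique-reverse simple

    forward-on : All (_∈ nodes) forward
    forward-on = All.tabulate (∈-rotate (c₁ ∷ c₂ ∷ c₃ ∷ []))

    backward-on : All (_∈ nodes) backward
    backward-on = All.tabulate (Any.reverse⁻ {xs = nodes})

    forward-closed : ∀ {x} → Adj H c₀ x → Linked (Adj H) (forward ∷ʳ x)
    forward-closed c₀∼x = c₁∼c₂ ∷ c₂∼c₃ ∷ c₃∼c₀ ∷ c₀∼x ∷ [-]

    backward-closed : ∀ {x} → Adj H c₀ x → Linked (Adj H) (backward ∷ʳ x)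
    backward-closed c₀∼x = adj-sym c₂∼c₃ ∷ adj-sym c₁∼c₂ ∷ adj-sym c₀∼c₁ ∷ c₀∼x ∷ [-]

  data Ear₄ (C : Cycle₄) (x : Node H) : Set where
    longer : CycleThrough≥ 6 x → Ear₄ C x
    chord₂ : Adj H x (Cycle₄.c₂ C) → Ear₄ C x

  close-ear₄ : (C : Cycle₄) {x : Node H} → Adj H (Cycle₄.c₀ C) x →
               Ear (_∈ Cycle₄.nodes C) (_≢ Cycle₄.c₀ C) x → Ear₄ C x
  close-ear₄ C {x} c₀∼x = λ where
      (mkEar _ _ _ _ _ (here refl) end≢c₀) → ⊥-elim (end≢c₀ refl)
      (mkEar [] _ (x∼c₁ ∷ _) _ _ (there (here refl)) _) → ⊥-elim (same-side⇒¬adj x≈c₁ x∼c₁)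
      E@(mkEar (_ ∷ I) _ _ _ _ (there (here refl)) _) →
        longer (close-ear E _ forward-simple forward-on (forward-closed c₀∼x) (m≤m+n 6 (length I)))
      (mkEar [] _ (x∼c₂ ∷ _) _ _ (there (there (here refl))) _) → chord₂ x∼c₂
      (mkEar (_ ∷ []) _ (x∼y ∷ y∼c₂ ∷ _) _ _ (there (there (here refl))) _) →
        ⊥-elim (same-side⇒¬adj (trans (same-side (adj-sym x∼y) x∼c₀) c₀≈c₂) y∼c₂)
      E@(mkEar (_ ∷ _ ∷ I) _ _ _ _ (there (there (here refl))) _) →
        longer (close-ear E _ (Unique.drop⁺ 1 forward-simple) (All.drop⁺ 1 forward-on)
                              (linked-drop 1 (forward-closed c₀∼x)) (m≤m+n 6 (length I)))
      (mkEar [] _ (x∼c₃ ∷ _) _ _ (there (there (there (here refl)))) _) → ⊥-elim (same-side⇒¬adj x≈c₃ x∼c₃)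
      E@(mkEar (_ ∷ I) _ _ _ _ (there (there (there (here refl)))) _) →
        longer (close-ear E _ backward-simple backward-on (backward-closed c₀∼x) (m≤m+n 6 (length I)))
    where
    open Cycle₄ C
    x∼c₀ : Adj H x c₀
    x∼c₀ = adj-sym c₀∼x
    x≈c₁ : side x ≡ side c₁
    x≈c₁ = same-side x∼c₀ c₀∼c₁
    x≈c₃ : side x ≡ side c₃
    x≈c₃ = same-side x∼c₀ (adj-sym c₃∼c₀)
    c₀≈c₂ : side c₀ ≡ side c₂
    c₀≈c₂ = same-side c₀∼c₁ c₁∼c₂

  -- Berge cycles of length 2 and 3

  Long : Set
  Long = HasBergeCycle≥ 4

  record Berge₂ : Set where
    field
      v₀ v₁ : Fin n
      e₀ e₁ : Fin (m H)
      v₀≢v₁ : v₀ ≢ v₁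
      e₀≢e₁ : e₀ ≢ e₁
      v₀∈e₀ : v₀ ∈ₑ e₀
      v₁∈e₀ : v₁ ∈ₑ e₀
      v₁∈e₁ : v₁ ∈ₑ e₁
      v₀∈e₁ : v₀ ∈ₑ e₁

    vertices : List (Fin n)
    vertices = v₀ ∷ v₁ ∷ []

    edges : List (Fin (m H))
    edges = e₀ ∷ e₁ ∷ []

    flags : BergeList (v₀ , e₀) ((v₁ , e₁) ∷ [])
    flags = record
      { vertices-unique = (v₀≢v₁ ∷ []) ∷ [] ∷ []
      ; edges-unique    = (e₀≢e₁ ∷ []) ∷ [] ∷ []
      ; incident        = v₀∈e₀ ∷ v₁∈e₁ ∷ []
      ; linked          = v₁∈e₀ ∷ v₀∈e₁ ∷ [-]
      }

    square-at-v₀ : Cycle₄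
    square-at-v₀ = record
      { c₀ = inj₁ v₀ ; c₁ = inj₂ e₀ ; c₂ = inj₁ v₁ ; c₃ = inj₂ e₁
      ; simple = ((λ ()) ∷ v₀≢v₁ ∘ inj₁-injective ∷ (λ ()) ∷ [])
               ∷ ((λ ()) ∷ e₀≢e₁ ∘ inj₂-injective ∷ []) ∷ ((λ ()) ∷ []) ∷ [] ∷ []
      ; c₀∼c₁ = v₀∈e₀ ; c₁∼c₂ = v₁∈e₀ ; c₂∼c₃ = v₁∈e₁ ; c₃∼c₀ = v₀∈e₁
      }

    square-at-e₀ : Cycle₄
    square-at-e₀ = record
      { c₀ = inj₂ e₀ ; c₁ = inj₁ v₁ ; c₂ = inj₂ e₁ ; c₃ = inj₁ v₀
      ; simple = ((λ ()) ∷ e₀≢e₁ ∘ inj₂-injective ∷ (λ ()) ∷ [])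
               ∷ ((λ ()) ∷ ≢-sym v₀≢v₁ ∘ inj₁-injective ∷ []) ∷ ((λ ()) ∷ []) ∷ [] ∷ []
      ; c₀∼c₁ = v₁∈e₀ ; c₁∼c₂ = v₁∈e₁ ; c₂∼c₃ = v₀∈e₁ ; c₃∼c₀ = v₀∈e₀
      }

  rotate₂ : Berge₂ → Berge₂
  rotate₂ C = record
    { v₀ = v₁ ; v₁ = v₀ ; e₀ = e₁ ; e₁ = e₀ ; v₀≢v₁ = ≢-sym v₀≢v₁ ; e₀≢e₁ = ≢-sym e₀≢e₁
    ; v₀∈e₀ = v₁∈e₁ ; v₁∈e₀ = v₀∈e₁ ; v₁∈e₁ = v₀∈e₀ ; v₀∈e₁ = v₁∈e₀
    }
    where open Berge₂ C

  record Berge₃ : Set where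
    field
      v₀ v₁ v₂ : Fin n
      e₀ e₁ e₂ : Fin (m H)
      v₀≢v₁ : v₀ ≢ v₁
      v₀≢v₂ : v₀ ≢ v₂
      v₁≢v₂ : v₁ ≢ v₂
      e₀≢e₁ : e₀ ≢ e₁
      e₀≢e₂ : e₀ ≢ e₂
      e₁≢e₂ : e₁ ≢ e₂
      v₀∈e₀ : v₀ ∈ₑ e₀
      v₁∈e₀ : v₁ ∈ₑ e₀
      v₁∈e₁ : v₁ ∈ₑ e₁
      v₂∈e₁ : v₂ ∈ₑ e₁
      v₂∈e₂ : v₂ ∈ₑ e₂
      v₀∈e₂ : v₀ ∈ₑ e₂

    vertices : List (Fin n)
    vertices = v₀ ∷ v₁ ∷ v₂ ∷ []

    edges : List (Fin (m H))
    edges = e₀ ∷ e₁ ∷ e₂ ∷ []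

    flags : BergeList (v₀ , e₀) ((v₁ , e₁) ∷ (v₂ , e₂) ∷ [])
    flags = record
      { vertices-unique = (v₀≢v₁ ∷ v₀≢v₂ ∷ []) ∷ (v₁≢v₂ ∷ []) ∷ [] ∷ []
      ; edges-unique    = (e₀≢e₁ ∷ e₀≢e₂ ∷ []) ∷ (e₁≢e₂ ∷ []) ∷ [] ∷ []
      ; incident        = v₀∈e₀ ∷ v₁∈e₁ ∷ v₂∈e₂ ∷ []
      ; linked          = v₁∈e₀ ∷ v₂∈e₁ ∷ v₀∈e₂ ∷ [-]
      }

    hexagon-at-v₀ : Cycle₆
    hexagon-at-v₀ = record
      { c₀ = inj₁ v₀ ; c₁ = inj₂ e₀ ; c₂ = inj₁ v₁ ; c₃ = inj₂ e₁ ; c₄ = inj₁ v₂ ; c₅ = inj₂ e₂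
      ; simple = ((λ ()) ∷ v₀≢v₁ ∘ inj₁-injective ∷ (λ ()) ∷ v₀≢v₂ ∘ inj₁-injective ∷ (λ ()) ∷ [])
               ∷ ((λ ()) ∷ e₀≢e₁ ∘ inj₂-injective ∷ (λ ()) ∷ e₀≢e₂ ∘ inj₂-injective ∷ [])
               ∷ ((λ ()) ∷ v₁≢v₂ ∘ inj₁-injective ∷ (λ ()) ∷ [])
               ∷ ((λ ()) ∷ e₁≢e₂ ∘ inj₂-injective ∷ []) ∷ ((λ ()) ∷ []) ∷ [] ∷ []
      ; c₀∼c₁ = v₀∈e₀ ; c₁∼c₂ = v₁∈e₀ ; c₂∼c₃ = v₁∈e₁ ; c₃∼c₄ = v₂∈e₁ ; c₄∼c₅ = v₂∈e₂ ; c₅∼c₀ = v₀∈e₂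
      }

    hexagon-at-e₀ : Cycle₆
    hexagon-at-e₀ = record
      { c₀ = inj₂ e₀ ; c₁ = inj₁ v₁ ; c₂ = inj₂ e₁ ; c₃ = inj₁ v₂ ; c₄ = inj₂ e₂ ; c₅ = inj₁ v₀
      ; simple = ((λ ()) ∷ e₀≢e₁ ∘ inj₂-injective ∷ (λ ()) ∷ e₀≢e₂ ∘ inj₂-injective ∷ (λ ()) ∷ [])
               ∷ ((λ ()) ∷ v₁≢v₂ ∘ inj₁-injective ∷ (λ ()) ∷ ≢-sym v₀≢v₁ ∘ inj₁-injective ∷ [])
               ∷ ((λ ()) ∷ e₁≢e₂ ∘ inj₂-injective ∷ (λ ()) ∷ [])
               ∷ ((λ ()) ∷ ≢-sym v₀≢v₂ ∘ inj₁-injective ∷ []) ∷ ((λ ()) ∷ []) ∷ [] ∷ []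
      ; c₀∼c₁ = v₁∈e₀ ; c₁∼c₂ = v₁∈e₁ ; c₂∼c₃ = v₂∈e₁ ; c₃∼c₄ = v₂∈e₂ ; c₄∼c₅ = v₀∈e₂ ; c₅∼c₀ = v₀∈e₀
      }

  rotate : Berge₃ → Berge₃
  rotate C = record
    { v₀ = v₁ ; v₁ = v₂ ; v₂ = v₀ ; e₀ = e₁ ; e₁ = e₂ ; e₂ = e₀
    ; v₀≢v₁ = v₁≢v₂ ; v₀≢v₂ = ≢-sym v₀≢v₁ ; v₁≢v₂ = ≢-sym v₀≢v₂
    ; e₀≢e₁ = e₁≢e₂ ; e₀≢e₂ = ≢-sym e₀≢e₁ ; e₁≢e₂ = ≢-sym e₀≢e₂
    ; v₀∈e₀ = v₁∈e₁ ; v₁∈e₀ = v₂∈e₁ ; v₁∈e₁ = v₂∈e₂ ; v₂∈e₁ = v₀∈e₂ ; v₂∈e₂ = v₀∈e₀ ; v₀∈e₂ = v₁∈e₀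
    }
    where open Berge₃ C

  reflect : Berge₃ → Berge₃
  reflect C = record
    { v₀ = v₀ ; v₁ = v₂ ; v₂ = v₁ ; e₀ = e₂ ; e₁ = e₁ ; e₂ = e₀
    ; v₀≢v₁ = v₀≢v₂ ; v₀≢v₂ = v₀≢v₁ ; v₁≢v₂ = ≢-sym v₁≢v₂
    ; e₀≢e₁ = ≢-sym e₁≢e₂ ; e₀≢e₂ = ≢-sym e₀≢e₂ ; e₁≢e₂ = ≢-sym e₀≢e₁
    ; v₀∈e₀ = v₀∈e₂ ; v₁∈e₀ = v₂∈e₂ ; v₁∈e₁ = v₂∈e₁ ; v₂∈e₁ = v₁∈e₁ ; v₂∈e₂ = v₁∈e₀ ; v₀∈e₂ = v₀∈e₀
    }
    where open Berge₃ C

  -- The Berge cycle v₀ g z h v₁ e₁ v₂ e₂, in which the path v₀ g z h v₁ replaces the edge e₀.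
  detour : (C : Berge₃) {z : Fin n} {g h : Fin (m H)} → let open Berge₃ C in
           v₀ ∈ₑ g → z ∈ₑ g → z ∈ₑ h → v₁ ∈ₑ h → All (z ≢_) vertices →
           g ≢ h → g ≢ e₁ → g ≢ e₂ → h ≢ e₁ → h ≢ e₂ → Long
  detour C v₀∈g z∈g z∈h v₁∈h (z≢v₀ ∷ z≢v₁ ∷ z≢v₂ ∷ []) g≢h g≢e₁ g≢e₂ h≢e₁ h≢e₂ =
    bergeList⇒HasBergeCycle≥ detoured ≤-refl
    where
    open Berge₃ C
    detoured : BergeList _ ((_ , _) ∷ (v₁ , e₁) ∷ (v₂ , e₂) ∷ [])
    detoured = record
      { vertices-unique = (≢-sym z≢v₀ ∷ v₀≢v₁ ∷ v₀≢v₂ ∷ []) ∷ (z≢v₁ ∷ z≢v₂ ∷ []) ∷ (v₁≢v₂ ∷ []) ∷ [] ∷ []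
      ; edges-unique    = (g≢h ∷ g≢e₁ ∷ g≢e₂ ∷ []) ∷ (h≢e₁ ∷ h≢e₂ ∷ []) ∷ (e₁≢e₂ ∷ []) ∷ [] ∷ []
      ; incident        = v₀∈g ∷ z∈h ∷ v₁∈e₁ ∷ v₂∈e₂ ∷ []
      ; linked          = z∈g ∷ v₁∈h ∷ v₂∈e₁ ∷ v₀∈e₂ ∷ [-]
      }

  module _ (Vs : List (Fin n)) (Es : List (Fin (m H))) where

    data Contact : Set where
      edge-meets-vertex : ∀ {g v} → All (g ≢_) Es → v ∈ Vs → v ∈ₑ g → Contact
      vertex-meets-edge : ∀ {w e y} → All (w ≢_) Vs → e ∈ Es → w ∈ₑ e → All (y ≢_) Es → w ∈ₑ y → Contact

    contact-from-edge   : ∀ {ok g v} → All (g ≢_) Es → v ∈ Vs → Walk H ok (inj₂ g) (inj₁ v) → Contact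
    contact-from-vertex : ∀ {ok w y v} → All (w ≢_) Vs → All (y ≢_) Es → w ∈ₑ y → v ∈ Vs →
                          Walk H ok (inj₁ w) (inj₁ v) → Contact

    contact-from-edge g∉Es v∈Vs (step {b = inj₁ u} _ u∈g walk) with Any.any? (u Finₚ.≟_) Vs
    ... | yes u∈Vs = edge-meets-vertex g∉Es u∈Vs u∈g
    ... | no  u∉Vs = contact-from-vertex (¬Any⇒All¬ Vs u∉Vs) g∉Es u∈g v∈Vs walk

    contact-from-vertex w∉Vs _ _ v∈Vs (here _) = ⊥-elim (All.lookup w∉Vs v∈Vs refl)
    contact-from-vertex w∉Vs y∉Es w∈y v∈Vs (step {b = inj₂ f} _ w∈f walk) with Any.any? (f Finₚ.≟_) Es
    ... | yes f∈Es = vertex-meets-edge w∉Vs f∈Es w∈f y∉Es w∈y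
    ... | no  f∉Es = contact-from-edge (¬Any⇒All¬ Es f∉Es) v∈Vs walk

  data VertexEar (C : Berge₃) (g : Fin (m H)) : Set where
    long       : Long → VertexEar C g
    through-v₁ : Berge₃.v₁ C ∈ₑ g → VertexEar C g
    through-v₂ : Berge₃.v₂ C ∈ₑ g → VertexEar C g
    meets-e₁   : ∀ u → All (u ≢_) (Berge₃.vertices C) → u ∈ₑ g → u ∈ₑ Berge₃.e₁ C → VertexEar C g

  data EdgeEar (C : Berge₃) (w : Fin n) : Set where
    long     : Long → EdgeEar C w
    in-e₁    : w ∈ₑ Berge₃.e₁ C → EdgeEar C w
    in-e₂    : w ∈ₑ Berge₃.e₂ C → EdgeEar C w
    meets-v₂ : ∀ h → All (h ≢_) (Berge₃.edges C) → w ∈ₑ h → Berge₃.v₂ C ∈ₑ h → EdgeEar C w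

  at-least-three : ∀ {p ps} → BergeList p ps → 3 ≤ length (p ∷ ps) → Long ⊎ Berge₃
  at-least-three {ps = []}                 _ (s≤s ())
  at-least-three {ps = _ ∷ []}             _ (s≤s (s≤s ()))
  at-least-three {ps = _ ∷ _ ∷ _ ∷ _} flags _ = inj₁ (bergeList⇒HasBergeCycle≥ flags (s≤s (s≤s (s≤s (s≤s z≤n)))))
  at-least-three {p = v₀ , e₀} {(v₁ , e₁) ∷ (v₂ , e₂) ∷ []} record
    { vertices-unique = (v₀≢v₁ ∷ v₀≢v₂ ∷ []) ∷ (v₁≢v₂ ∷ []) ∷ [] ∷ []
    ; edges-unique    = (e₀≢e₁ ∷ e₀≢e₂ ∷ []) ∷ (e₁≢e₂ ∷ []) ∷ [] ∷ []
    ; incident        = v₀∈e₀ ∷ v₁∈e₁ ∷ v₂∈e₂ ∷ []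
    ; linked          = v₁∈e₀ ∷ v₂∈e₁ ∷ v₀∈e₂ ∷ [-]
    } _ = inj₂ (record
    { v₀ = v₀ ; v₁ = v₁ ; v₂ = v₂ ; e₀ = e₀ ; e₁ = e₁ ; e₂ = e₂
    ; v₀≢v₁ = v₀≢v₁ ; v₀≢v₂ = v₀≢v₂ ; v₁≢v₂ = v₁≢v₂ ; e₀≢e₁ = e₀≢e₁ ; e₀≢e₂ = e₀≢e₂ ; e₁≢e₂ = e₁≢e₂
    ; v₀∈e₀ = v₀∈e₀ ; v₁∈e₀ = v₁∈e₀ ; v₁∈e₁ = v₁∈e₁ ; v₂∈e₁ = v₂∈e₁ ; v₂∈e₂ = v₂∈e₂ ; v₀∈e₂ = v₀∈e₂
    })

  at-least-two : ∀ {p ps} → BergeList p ps → 2 ≤ length (p ∷ ps) → Berge₂ ⊎ Long ⊎ Berge₃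
  at-least-two {ps = []}                  _ (s≤s ())
  at-least-two {p = v₀ , e₀} {(v₁ , e₁) ∷ []} record
    { vertices-unique = (v₀≢v₁ ∷ []) ∷ [] ∷ []
    ; edges-unique    = (e₀≢e₁ ∷ []) ∷ [] ∷ []
    ; incident        = v₀∈e₀ ∷ v₁∈e₁ ∷ []
    ; linked          = v₁∈e₀ ∷ v₀∈e₁ ∷ [-]
    } _ = inj₁ (record
    { v₀ = v₀ ; v₁ = v₁ ; e₀ = e₀ ; e₁ = e₁ ; v₀≢v₁ = v₀≢v₁ ; e₀≢e₁ = e₀≢e₁
    ; v₀∈e₀ = v₀∈e₀ ; v₁∈e₀ = v₁∈e₀ ; v₁∈e₁ = v₁∈e₁ ; v₀∈e₁ = v₀∈e₁
    })
  at-least-two {ps = _ ∷ _ ∷ _} flags _ = inj₂ (at-least-three flags (s≤s (s≤s (s≤s z≤n))))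

  cycle≥6⇒long⊎berge₃ : ∀ {x} → CycleThrough≥ 6 x → Long ⊎ Berge₃
  cycle≥6⇒long⊎berge₃ cycle with cycle⇒bergeList≥ {L = 3} cycle
  ... | _ , _ , flags , 3≤ = at-least-three flags 3≤

  module _ (no-cut : ∀ x → ConnectedWithout H x) where

    ear₆ : (C : Cycle₆) {x : Node H} → x ∉ Cycle₆.nodes C → Adj H (Cycle₆.c₀ C) x → Ear₆ C x
    ear₆ C {x} x∉C c₀∼x with find-ear (_∈? nodes) (no-cut c₀ x c₁ (x∉C ∘ here) c₁≢c₀) (there (here refl))
      where
      open Cycle₆ C
      c₁≢c₀ : c₁ ≢ c₀
      c₁≢c₀ c₁≡c₀ = Unique[x∷xs]⇒x∉xs simple (here (sym c₁≡c₀))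
    ... | inj₁ x∈C = ⊥-elim (x∉C x∈C)
    ... | inj₂ E   = close-ear₆ C c₀∼x E

    ear₄ : (C : Cycle₄) {x : Node H} → x ∉ Cycle₄.nodes C → Adj H (Cycle₄.c₀ C) x → Ear₄ C x
    ear₄ C {x} x∉C c₀∼x with find-ear (_∈? nodes) (no-cut c₀ x c₁ (x∉C ∘ here) c₁≢c₀) (there (here refl))
      where
      open Cycle₄ C
      c₁≢c₀ : c₁ ≢ c₀
      c₁≢c₀ c₁≡c₀ = Unique[x∷xs]⇒x∉xs simple (here (sym c₁≡c₀))
    ... | inj₁ x∈C = ⊥-elim (x∉C x∈C)
    ... | inj₂ E   = close-ear₄ C c₀∼x E

    vertex-ear : (C : Berge₃) {g : Fin (m H)} → All (g ≢_) (Berge₃.edges C) → Berge₃.v₀ C ∈ₑ g → VertexEar C g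
    vertex-ear C {g} (g≢e₀ ∷ g≢e₁ ∷ g≢e₂ ∷ []) v₀∈g with ear₆ (Berge₃.hexagon-at-v₀ C) g∉C v₀∈g
      where
      g∉C : inj₂ g ∉ Cycle₆.nodes (Berge₃.hexagon-at-v₀ C)
      g∉C (there (here g≡e₀))                         = g≢e₀ (inj₂-injective g≡e₀)
      g∉C (there (there (there (here g≡e₁))))         = g≢e₁ (inj₂-injective g≡e₁)
      g∉C (there (there (there (there (there (here g≡e₂)))))) = g≢e₂ (inj₂-injective g≡e₂)
    ... | longer cycle             = long (cycle⇒HasBergeCycle≥ cycle)
    ... | chord₂ v₁∈g              = through-v₁ v₁∈g
    ... | chord₄ v₂∈g              = through-v₂ v₂∈g
    ... | bridge₃ (inj₁ u) u∉C u∈g u∈e₁ = meets-e₁ u u-fresh u∈g u∈e₁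
      where
      u-fresh : All (u ≢_) (Berge₃.vertices C)
      u-fresh = (u∉C ∘ here ∘ cong inj₁) ∷ (u∉C ∘ there ∘ there ∘ here ∘ cong inj₁)
              ∷ (u∉C ∘ there ∘ there ∘ there ∘ there ∘ here ∘ cong inj₁) ∷ []

    edge-ear : (C : Berge₃) {w : Fin n} → All (w ≢_) (Berge₃.vertices C) → w ∈ₑ Berge₃.e₀ C → EdgeEar C w
    edge-ear C {w} (w≢v₀ ∷ w≢v₁ ∷ w≢v₂ ∷ []) w∈e₀ with ear₆ (Berge₃.hexagon-at-e₀ C) w∉C w∈e₀
      where
      w∉C : inj₁ w ∉ Cycle₆.nodes (Berge₃.hexagon-at-e₀ C)
      w∉C (there (here w≡v₁))                                 = w≢v₁ (inj₁-injective w≡v₁)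
      w∉C (there (there (there (here w≡v₂))))                 = w≢v₂ (inj₁-injective w≡v₂)
      w∉C (there (there (there (there (there (here w≡v₀)))))) = w≢v₀ (inj₁-injective w≡v₀)
    ... | longer cycle             = long (cycle⇒HasBergeCycle≥ cycle)
    ... | chord₂ w∈e₁              = in-e₁ w∈e₁
    ... | chord₄ w∈e₂              = in-e₂ w∈e₂
    ... | bridge₃ (inj₂ h) h∉C w∈h v₂∈h = meets-v₂ h h-fresh w∈h v₂∈h
      where
      h-fresh : All (h ≢_) (Berge₃.edges C)
      h-fresh = (h∉C ∘ here ∘ cong inj₂) ∷ (h∉C ∘ there ∘ there ∘ here ∘ cong inj₂)
              ∷ (h∉C ∘ there ∘ there ∘ there ∘ there ∘ here ∘ cong inj₂) ∷ []

    vertex-ear₂ : (C : Berge₂) {g : Fin (m H)} → All (g ≢_) (Berge₂.edges C) → Berge₂.v₀ C ∈ₑ g →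
                  CycleThrough≥ 6 (inj₂ g) ⊎ Berge₂.v₁ C ∈ₑ g
    vertex-ear₂ C {g} (g≢e₀ ∷ g≢e₁ ∷ []) v₀∈g with ear₄ (Berge₂.square-at-v₀ C) g∉C v₀∈g
      where
      g∉C : inj₂ g ∉ Cycle₄.nodes (Berge₂.square-at-v₀ C)
      g∉C (there (here g≡e₀))                 = g≢e₀ (inj₂-injective g≡e₀)
      g∉C (there (there (there (here g≡e₁)))) = g≢e₁ (inj₂-injective g≡e₁)
    ... | longer cycle = inj₁ cycle
    ... | chord₂ v₁∈g  = inj₂ v₁∈g

    edge-ear₂ : (C : Berge₂) {w : Fin n} → All (w ≢_) (Berge₂.vertices C) → w ∈ₑ Berge₂.e₀ C →
                CycleThrough≥ 6 (inj₁ w) ⊎ w ∈ₑ Berge₂.e₁ C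
    edge-ear₂ C {w} (w≢v₀ ∷ w≢v₁ ∷ []) w∈e₀ with ear₄ (Berge₂.square-at-e₀ C) w∉C w∈e₀
      where
      w∉C : inj₁ w ∉ Cycle₄.nodes (Berge₂.square-at-e₀ C)
      w∉C (there (here w≡v₁))                 = w≢v₁ (inj₁-injective w≡v₁)
      w∉C (there (there (there (here w≡v₀)))) = w≢v₀ (inj₁-injective w≡v₀)
    ... | longer cycle = inj₁ cycle
    ... | chord₂ w∈e₁  = inj₂ w∈e₁

    -- Lengthening short Berge cycles

    module _ (3≤r : 3 ≤ r) (connected : Connected H) where

      3≤∣edge∣ : ∀ e → 3 ≤ ∣ edge H e ∣
      3≤∣edge∣ e = ≤-trans 3≤r (≤-reflexive (sym (uniform H e)))

      ∃-fresh-edge : ∀ (es : List (Fin (m H))) → length es < m H → ∃ λ g → All (g ≢_) es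
      ∃-fresh-edge es es<m with ∃-fresh es Subset.⊤ (<-≤-trans es<m (≤-reflexive (sym (∣⊤∣≡n (m H)))))
      ... | g , _ , g∉es = g , g∉es

      chord-and-fresh-vertex : (C : Berge₃) {g : Fin (m H)} {z : Fin n} → let open Berge₃ C in
                               All (g ≢_) edges → v₀ ∈ₑ g → v₁ ∈ₑ g → z ∈ₑ g → All (z ≢_) vertices → Long
      chord-and-fresh-vertex C {g} {z} (g≢e₀ ∷ g≢e₁ ∷ g≢e₂ ∷ []) v₀∈g v₁∈g z∈g z-fresh@(z≢v₀ ∷ z≢v₁ ∷ z≢v₂ ∷ []) =
        from-ear (edge-ear C′ z-fresh z∈g)
        where
        open Berge₃ C
        C′ : Berge₃
        C′ = record C { e₀ = g ; e₀≢e₁ = g≢e₁ ; e₀≢e₂ = g≢e₂ ; v₀∈e₀ = v₀∈g ; v₁∈e₀ = v₁∈g }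
        from-ear : EdgeEar C′ z → Long
        from-ear (long cycle)  = cycle
        from-ear (in-e₁ z∈e₁) =
          detour (rotate C) v₁∈g z∈g z∈e₁ v₂∈e₁ (z≢v₁ ∷ z≢v₂ ∷ z≢v₀ ∷ []) g≢e₁ g≢e₂ g≢e₀ e₁≢e₂ (≢-sym e₀≢e₁)
        from-ear (in-e₂ z∈e₂) =
          detour (reflect C) v₀∈g z∈g z∈e₂ v₂∈e₂ (z≢v₀ ∷ z≢v₂ ∷ z≢v₁ ∷ []) g≢e₂ g≢e₁ g≢e₀ (≢-sym e₁≢e₂) (≢-sym e₀≢e₂)
        from-ear (meets-v₂ h (h≢g ∷ h≢e₁ ∷ h≢e₂ ∷ []) z∈h v₂∈h) with h Finₚ.≟ e₀
        ... | yes refl = detour C v₀∈g z∈g z∈h v₁∈e₀ z-fresh g≢e₀ g≢e₁ g≢e₂ e₀≢e₁ e₀≢e₂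
        ... | no  h≢e₀ = detour (reflect C) v₀∈g z∈g z∈h v₂∈h (z≢v₀ ∷ z≢v₂ ∷ z≢v₁ ∷ []) (≢-sym h≢g) g≢e₁ g≢e₀ h≢e₁ h≢e₀

      chord-inside-cycle : (C : Berge₃) {g : Fin (m H)} {w : Fin n} → let open Berge₃ C in
                           All (g ≢_) edges → v₀ ∈ₑ g → v₁ ∈ₑ g → edge H g ⊆ ⋃⁅ vertices ⁆ →
                           w ∈ₑ e₀ → All (w ≢_) vertices → Long
      chord-inside-cycle C {g} {w} (g≢e₀ ∷ g≢e₁ ∷ g≢e₂ ∷ []) v₀∈g v₁∈g g⊆C w∈e₀ w-fresh@(w≢v₀ ∷ w≢v₁ ∷ w≢v₂ ∷ []) =
        from-ear (edge-ear C w-fresh w∈e₀)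
        where
        open Berge₃ C
        C′ : Berge₃
        C′ = record C { e₀ = g ; e₀≢e₁ = g≢e₁ ; e₀≢e₂ = g≢e₂ ; v₀∈e₀ = v₀∈g ; v₁∈e₀ = v₁∈g }
        from-ear : EdgeEar C w → Long
        from-ear (long cycle)  = cycle
        from-ear (in-e₁ w∈e₁) =
          detour (rotate C′) v₁∈e₀ w∈e₀ w∈e₁ v₂∈e₁ (w≢v₁ ∷ w≢v₂ ∷ w≢v₀ ∷ []) e₀≢e₁ e₀≢e₂ (≢-sym g≢e₀) e₁≢e₂ (≢-sym g≢e₁)
        from-ear (in-e₂ w∈e₂) =
          detour (reflect C′) v₀∈e₀ w∈e₀ w∈e₂ v₂∈e₂ (w≢v₀ ∷ w≢v₂ ∷ w≢v₁ ∷ [])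
                 e₀≢e₂ e₀≢e₁ (≢-sym g≢e₀) (≢-sym e₁≢e₂) (≢-sym g≢e₂)
        from-ear (meets-v₂ h (h≢e₀ ∷ h≢e₁ ∷ h≢e₂ ∷ []) w∈h v₂∈h) with h Finₚ.≟ g
        ... | yes refl = ⊥-elim (All.lookup w-fresh (∈⋃⁅xs⁆⇒∈ vertices (g⊆C w∈h)) refl)
        ... | no  h≢g  =
          detour (reflect C′) v₀∈e₀ w∈e₀ w∈h v₂∈h (w≢v₀ ∷ w≢v₂ ∷ w≢v₁ ∷ []) (≢-sym h≢e₀) e₀≢e₁ (≢-sym g≢e₀) h≢e₁ h≢g

      lengthen-by-chord : (C : Berge₃) {g : Fin (m H)} → All (g ≢_) (Berge₃.edges C) →
                          Berge₃.v₀ C ∈ₑ g → Berge₃.v₁ C ∈ₑ g → Long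
      lengthen-by-chord C {g} g-fresh@(g≢e₀ ∷ _) v₀∈g v₁∈g with fresh-or-⊆ (Berge₃.vertices C) (edge H g)
      ... | inj₁ (z , z∈g , z-fresh) = chord-and-fresh-vertex C g-fresh v₀∈g v₁∈g z∈g z-fresh
      ... | inj₂ g⊆C with ∃-fresh-in-other (Berge₃.vertices C) g⊆C (3≤∣edge∣ g)
                            (trans (uniform H g) (sym (uniform H (Berge₃.e₀ C)))) (g≢e₀ ∘ distinct H)
      ...   | w , w∈e₀ , w-fresh = chord-inside-cycle C g-fresh v₀∈g v₁∈g g⊆C w∈e₀ w-fresh

      bridge-and-vertex-off-e₁ : (C : Berge₃) {g : Fin (m H)} {u y : Fin n} → let open Berge₃ C in
                                 All (g ≢_) edges → v₀ ∈ₑ g → All (u ≢_) vertices → u ∈ₑ g → u ∈ₑ e₁ →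
                                 y ∈ₑ g → y ≢ v₀ → ¬ y ∈ₑ e₁ → Long
      bridge-and-vertex-off-e₁ C {g} {u} {y} (g≢e₀ ∷ g≢e₁ ∷ g≢e₂ ∷ []) v₀∈g (u≢v₀ ∷ u≢v₁ ∷ _ ∷ []) u∈g u∈e₁
                               y∈g y≢v₀ y∉e₁ =
        from-ear (edge-ear (reflect D) (y≢v₀ ∷ y≢u ∷ y≢v₁ ∷ []) y∈g)
        where
        open Berge₃ C
        D : Berge₃
        D = record C { v₂ = u ; e₂ = g ; v₀≢v₂ = ≢-sym u≢v₀ ; v₁≢v₂ = ≢-sym u≢v₁ ; e₀≢e₂ = ≢-sym g≢e₀ ; e₁≢e₂ = ≢-sym g≢e₁
                     ; v₂∈e₁ = u∈e₁ ; v₂∈e₂ = u∈g ; v₀∈e₂ = v₀∈g }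
        y≢-on-e₁ : ∀ {x} → x ∈ₑ e₁ → y ≢ x
        y≢-on-e₁ x∈e₁ refl = y∉e₁ x∈e₁
        y≢v₁ = y≢-on-e₁ v₁∈e₁
        y≢v₂ = y≢-on-e₁ v₂∈e₁
        y≢u  = y≢-on-e₁ u∈e₁
        from-ear : EdgeEar (reflect D) y → Long
        from-ear (long cycle)  = cycle
        from-ear (in-e₁ y∈e₁) = ⊥-elim (y∉e₁ y∈e₁)
        from-ear (in-e₂ y∈e₀) = detour C v₀∈g y∈g y∈e₀ v₁∈e₀ (y≢v₀ ∷ y≢v₁ ∷ y≢v₂ ∷ []) g≢e₀ g≢e₁ g≢e₂ e₀≢e₁ e₀≢e₂
        from-ear (meets-v₂ h (h≢g ∷ h≢e₁ ∷ h≢e₀ ∷ []) y∈h v₁∈h) with h Finₚ.≟ e₂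
        ... | yes refl =
          detour (rotate (rotate D)) u∈g y∈g y∈h v₀∈e₂ (y≢u ∷ y≢v₀ ∷ y≢v₁ ∷ []) g≢e₂ g≢e₀ g≢e₁ (≢-sym e₀≢e₂) (≢-sym e₁≢e₂)
        ... | no  h≢e₂ = detour C v₀∈g y∈g y∈h v₁∈h (y≢v₀ ∷ y≢v₁ ∷ y≢v₂ ∷ []) (≢-sym h≢g) g≢e₁ g≢e₂ h≢e₁ h≢e₂

      lengthen-by-bridge : (C : Berge₃) {g : Fin (m H)} {u : Fin n} → let open Berge₃ C in
                           All (g ≢_) edges → v₀ ∈ₑ g → All (u ≢_) vertices → u ∈ₑ g → u ∈ₑ e₁ → Long
      lengthen-by-bridge C {g} g-fresh@(g≢e₀ ∷ g≢e₁ ∷ g≢e₂ ∷ []) v₀∈g u-fresh@(u≢v₀ ∷ u≢v₁ ∷ u≢v₂ ∷ []) u∈g u∈e₁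
        with Berge₃.v₁ C ∈ˢ? edge H g | Berge₃.v₂ C ∈ˢ? edge H g
      ... | yes v₁∈g | _ =
        detour (rotate C) v₁∈g u∈g u∈e₁ v₂∈e₁ (u≢v₁ ∷ u≢v₂ ∷ u≢v₀ ∷ []) g≢e₁ g≢e₂ g≢e₀ e₁≢e₂ (≢-sym e₀≢e₁)
        where open Berge₃ C
      ... | no _ | yes v₂∈g =
        detour (rotate (reflect C)) v₂∈g u∈g u∈e₁ v₁∈e₁ (u≢v₂ ∷ u≢v₁ ∷ u≢v₀ ∷ []) g≢e₁ g≢e₀ g≢e₂ (≢-sym e₀≢e₁) e₁≢e₂
        where open Berge₃ C
      ... | no v₁∉g | no v₂∉g
        with any? (λ y → y ∈ˢ? edge H g ×-dec (¬? (y Finₚ.≟ Berge₃.v₀ C) ×-dec ¬? (y ∈ˢ? edge H (Berge₃.e₁ C))))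
      ...   | yes (y , y∈g , y≢v₀ , y∉e₁) = bridge-and-vertex-off-e₁ C g-fresh v₀∈g u-fresh u∈g u∈e₁ y∈g y≢v₀ y∉e₁
      ...   | no none =
        ⊥-elim (<-irrefl (trans (uniform H g) (sym (uniform H e₁))) (p⊆q∪⁅a⁆⇒∣p∣<∣q∣ g⊆e₁∪v₀ v₁∈e₁ v₂∈e₁ v₁∉g v₂∉g v₁≢v₂))
        where
        open Berge₃ C
        g⊆e₁∪v₀ : edge H g ⊆ edge H e₁ ∪ ⁅ v₀ ⁆
        g⊆e₁∪v₀ {y} y∈g with y Finₚ.≟ v₀ | y ∈ˢ? edge H e₁
        ... | yes refl | _        = q⊆p∪q (edge H e₁) ⁅ v₀ ⁆ (x∈⁅x⁆ v₀)
        ... | no _     | yes y∈e₁ = p⊆p∪q ⁅ v₀ ⁆ y∈e₁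
        ... | no y≢v₀  | no y∉e₁  = ⊥-elim (none (y , y∈g , y≢v₀ , y∉e₁))

      lengthen-at-vertex : (C : Berge₃) {g : Fin (m H)} → All (g ≢_) (Berge₃.edges C) → Berge₃.v₀ C ∈ₑ g → Long
      lengthen-at-vertex C g-fresh@(g≢e₀ ∷ g≢e₁ ∷ g≢e₂ ∷ []) v₀∈g with vertex-ear C g-fresh v₀∈g
      ... | long cycle                     = cycle
      ... | through-v₁ v₁∈g                = lengthen-by-chord C g-fresh v₀∈g v₁∈g
      ... | through-v₂ v₂∈g                = lengthen-by-chord (reflect C) (g≢e₂ ∷ g≢e₁ ∷ g≢e₀ ∷ []) v₀∈g v₂∈g
      ... | meets-e₁ u u-fresh u∈g u∈e₁    = lengthen-by-bridge C g-fresh v₀∈g u-fresh u∈g u∈e₁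

      lengthen-at-edge : (C : Berge₃) {w : Fin n} {y : Fin (m H)} → let open Berge₃ C in
                         All (w ≢_) vertices → w ∈ₑ e₀ → All (y ≢_) edges → w ∈ₑ y → Long
      lengthen-at-edge C {w} w-fresh@(w≢v₀ ∷ w≢v₁ ∷ w≢v₂ ∷ []) w∈e₀ y-fresh w∈y with edge-ear C w-fresh w∈e₀
      ... | long cycle  = cycle
      ... | in-e₁ w∈e₁  =
        lengthen-at-vertex (rotate (record C { v₁ = w ; v₀≢v₁ = ≢-sym w≢v₀ ; v₁≢v₂ = w≢v₂ ; v₁∈e₀ = w∈e₀ ; v₁∈e₁ = w∈e₁ }))
                           (all-rotate y-fresh) w∈y
      ... | in-e₂ w∈e₂  =
        lengthen-at-vertex (record C { v₀ = w ; v₀≢v₁ = w≢v₁ ; v₀≢v₂ = w≢v₂ ; v₀∈e₀ = w∈e₀ ; v₀∈e₂ = w∈e₂ }) y-fresh w∈y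
      ... | meets-v₂ h h-fresh _ v₂∈h = lengthen-at-vertex (rotate (rotate C)) (all-rotate (all-rotate h-fresh)) v₂∈h

      extend₃ : Berge₃ → 3 < m H → Long
      extend₃ C 3<m with ∃-fresh-edge (Berge₃.edges C) 3<m
      ... | g , g-fresh
        with contact-from-edge (Berge₃.vertices C) (Berge₃.edges C) g-fresh (here refl) (connected (inj₂ g) (inj₁ (Berge₃.v₀ C)))
      ...   | edge-meets-vertex g′-fresh (here refl) v∈g′ =
        lengthen-at-vertex C g′-fresh v∈g′
      ...   | edge-meets-vertex g′-fresh (there (here refl)) v∈g′ =
        lengthen-at-vertex (rotate C) (all-rotate g′-fresh) v∈g′
      ...   | edge-meets-vertex g′-fresh (there (there (here refl))) v∈g′ =
        lengthen-at-vertex (rotate (rotate C)) (all-rotate (all-rotate g′-fresh)) v∈g′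
      ...   | vertex-meets-edge w-fresh (here refl) w∈e y-fresh w∈y =
        lengthen-at-edge C w-fresh w∈e y-fresh w∈y
      ...   | vertex-meets-edge w-fresh (there (here refl))         w∈e y-fresh w∈y =
        lengthen-at-edge (rotate C) (all-rotate w-fresh) w∈e (all-rotate y-fresh) w∈y
      ...   | vertex-meets-edge w-fresh (there (there (here refl))) w∈e y-fresh w∈y =
        lengthen-at-edge (rotate (rotate C)) (all-rotate (all-rotate w-fresh)) w∈e (all-rotate (all-rotate y-fresh)) w∈y

      extend₂-at-vertex : (C : Berge₂) {g : Fin (m H)} → All (g ≢_) (Berge₂.edges C) → Berge₂.v₀ C ∈ₑ g → Long ⊎ Berge₃
      extend₂-at-vertex C {g} g-fresh@(g≢e₀ ∷ g≢e₁ ∷ []) v₀∈g with vertex-ear₂ C g-fresh v₀∈g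
      ... | inj₁ cycle = cycle≥6⇒long⊎berge₃ cycle
      ... | inj₂ v₁∈g with ∃-fresh (Berge₂.vertices C) (edge H g) (3≤∣edge∣ g)
      ...   | z , z∈g , z-fresh
        with edge-ear₂ (record C { e₀ = g ; e₀≢e₁ = g≢e₁ ; v₀∈e₀ = v₀∈g ; v₁∈e₀ = v₁∈g }) z-fresh z∈g
      ...     | inj₁ cycle = cycle≥6⇒long⊎berge₃ cycle
      ...     | inj₂ z∈e₁  = inj₂ (triangle z-fresh)
        where
        open Berge₂ C
        triangle : All (z ≢_) vertices → Berge₃
        triangle (z≢v₀ ∷ z≢v₁ ∷ []) = record
          { v₀ = v₀ ; v₁ = z ; v₂ = v₁ ; e₀ = g ; e₁ = e₁ ; e₂ = e₀
          ; v₀≢v₁ = ≢-sym z≢v₀ ; v₀≢v₂ = v₀≢v₁ ; v₁≢v₂ = z≢v₁ ; e₀≢e₁ = g≢e₁ ; e₀≢e₂ = g≢e₀ ; e₁≢e₂ = ≢-sym e₀≢e₁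
          ; v₀∈e₀ = v₀∈g ; v₁∈e₀ = z∈g ; v₁∈e₁ = z∈e₁ ; v₂∈e₁ = v₁∈e₁ ; v₂∈e₂ = v₁∈e₀ ; v₀∈e₂ = v₀∈e₀
          }

      extend₂-at-edge : (C : Berge₂) {w : Fin n} {y : Fin (m H)} → let open Berge₂ C in
                        All (w ≢_) vertices → w ∈ₑ e₀ → All (y ≢_) edges → w ∈ₑ y → Long ⊎ Berge₃
      extend₂-at-edge C {w} w-fresh@(w≢v₀ ∷ _) w∈e₀ y-fresh w∈y with edge-ear₂ C w-fresh w∈e₀
      ... | inj₁ cycle = cycle≥6⇒long⊎berge₃ cycle
      ... | inj₂ w∈e₁  =
        extend₂-at-vertex (rotate₂ (record C { v₁ = w ; v₀≢v₁ = ≢-sym w≢v₀ ; v₁∈e₀ = w∈e₀ ; v₁∈e₁ = w∈e₁ }))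
                          (all-rotate y-fresh) w∈y

      extend₂ : Berge₂ → 2 < m H → Long ⊎ Berge₃
      extend₂ C 2<m with ∃-fresh-edge (Berge₂.edges C) 2<m
      ... | g , g-fresh
        with contact-from-edge (Berge₂.vertices C) (Berge₂.edges C) g-fresh (here refl) (connected (inj₂ g) (inj₁ (Berge₂.v₀ C)))
      ...   | edge-meets-vertex g′-fresh (here refl) v∈g′ =
        extend₂-at-vertex C g′-fresh v∈g′
      ...   | edge-meets-vertex g′-fresh (there (here refl)) v∈g′ =
        extend₂-at-vertex (rotate₂ C) (all-rotate g′-fresh) v∈g′
      ...   | vertex-meets-edge w-fresh (here refl) w∈e y-fresh w∈y =
        extend₂-at-edge C w-fresh w∈e y-fresh w∈y
      ...   | vertex-meets-edge w-fresh (there (here refl)) w∈e y-fresh w∈y =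
        extend₂-at-edge (rotate₂ C) (all-rotate w-fresh) w∈e (all-rotate y-fresh) w∈y

      first-cycle : ∀ {a b : Fin n} → a ≢ b → Berge₂ ⊎ Long ⊎ Berge₃
      first-cycle {a} {b} a≢b with connected (inj₁ a) (inj₁ b)
      ... | here _ = ⊥-elim (a≢b refl)
      ... | step {b = inj₂ e} _ a∈e _ with ∃-fresh (a ∷ []) (edge H e) (<⇒≤ (3≤∣edge∣ e))
      ...   | c , c∈e , c≢a ∷ [] with find-ear (_∈? inj₁ c ∷ inj₂ e ∷ [])
                                              (no-cut (inj₂ e) (inj₁ a) (inj₁ c) (λ ()) (λ ())) (here refl)
      ...     | inj₁ (here a≡c) = ⊥-elim (c≢a (sym (inj₁-injective a≡c)))
      ...     | inj₁ (there (here ()))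
      ...     | inj₂ (mkEar [] _ (() ∷ _) _ _ (here refl) _)
      ...     | inj₂ (mkEar _ _ _ _ _ (there (here refl)) e≢e) = ⊥-elim (e≢e refl)
      ...     | inj₂ E@(mkEar (_ ∷ I) _ _ _ _ (here refl) _)
        with cycle⇒bergeList≥ {L = 2} (close-ear E (inj₂ e ∷ []) (((λ ()) ∷ []) ∷ [] ∷ [])
                                                  (here refl ∷ there (here refl) ∷ []) (c∈e ∷ a∈e ∷ [-]) (m≤m+n 4 (length I)))
      ...       | _ , _ , flags , 2≤ = at-least-two flags 2≤

      from-long : Long → HasBergeCycle≥ (4 ⊓ m H)
      from-long = HasBergeCycle≥-mono (m⊓n≤m 4 (m H))

      from-berge₃ : Berge₃ → HasBergeCycle≥ (4 ⊓ m H)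
      from-berge₃ C with 3 <? m H
      ... | yes 3<m = from-long (extend₃ C 3<m)
      ... | no  3≮m = bergeList⇒HasBergeCycle≥ (Berge₃.flags C) (≤-trans (m⊓n≤n 4 (m H)) (≮⇒≥ 3≮m))

      from-berge₂ : Berge₂ → HasBergeCycle≥ (4 ⊓ m H)
      from-berge₂ C with 2 <? m H
      ... | yes 2<m = [ from-long , from-berge₃ ]′ (extend₂ C 2<m)
      ... | no  2≮m = bergeList⇒HasBergeCycle≥ (Berge₂.flags C) (≤-trans (m⊓n≤n 4 (m H)) (≮⇒≥ 2≮m))

      berge-cycle≥4⊓m : ∀ {a b : Fin n} → a ≢ b → HasBergeCycle≥ (4 ⊓ m H)
      berge-cycle≥4⊓m a≢b = [ from-berge₂ , [ from-long , from-berge₃ ]′ ]′ (first-cycle a≢b)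

two-distinct : ∀ {n} → 2 ≤ n → ∃₂ λ (a b : Fin n) → a ≢ b
two-distinct {suc (suc n)} _         = zero , suc zero , λ ()
two-distinct {suc zero}    (s≤s ())

proposition1p8 : (n r : ℕ) → 3 ≤ r → r < n → (H : Hypergraph n r) → TwoConnected H →
    HasBergeCycleOfLengthAtLeast H (4 ⊓ (n ⊓ m H))
proposition1p8 n r 3≤r r<n H (_ , connected , no-cut) with two-distinct (≤-trans (s≤s (s≤s z≤n)) (≤-trans 3≤r (<⇒≤ r<n)))
... | a , b , a≢b = HasBergeCycle≥-mono H (⊓-monoʳ-≤ 4 (m⊓n≤n n (m H))) (berge-cycle≥4⊓m H no-cut 3≤r connected a≢b)
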